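{- For all $n\ge1$ and $1\le k\le n$, the number of U-words $u$ of length $n$ with $u_n=n+1-k$ equals $E_{n,k}$.
   Context: $E_{n,k}$ is the number of permutations $\pi$ of $\{1,\dots,n\}$ with $\pi_1>\pi_2<\pi_3>\cdots$ and $\pi_1=k$. A U-word of length $n$ is a sequence $u=(u_1,\dots,u_n)$ of positive integers with $u_1=1$ and $u_i+u_{i-1}\le i$ for $2\le i\le n$. -}

module Defs where

open import Data.Nat using (ℕ; zero; suc; _+_; _≤_; _<_; _≤?_; _<?_)
open import Data.Nat.Properties using () renaming (_≟_ to _≟ℕ_)
open import Data.List using (List; []; _∷_; length; filter; map; concatMap; applyUpTo; head; last)
open import Data.Maybe using (Maybe; just)
open import Data.Maybe.Properties using (≡-dec)
open import Data.Product using (_×_; _,_)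
open import Data.Unit using (⊤; tt)
open import Relation.Nullary using (Dec; yes)
open import Relation.Nullary.Decidable using (_×-dec_)
open import Relation.Binary.PropositionalEquality using (_≡_)
open import Data.List.Relation.Unary.Unique.Propositional using (Unique)
import Data.List.Relation.Unary.Unique.DecPropositional as UDec

range1 : ℕ → List ℕ
range1 b = applyUpTo suc b

words : ℕ → ℕ → List (List ℕ)
words zero    b = [] ∷ []
words (suc n) b = concatMap (λ x → map (x ∷_) (words n b)) (range1 b)

count : {P : List ℕ → Set} → ((w : List ℕ) → Dec (P w)) → List (List ℕ) → ℕ
count P? ws = length (filter P? ws)

mutual
  DownUp : List ℕ → Set
  DownUp []            = ⊤
  DownUp (x ∷ [])      = ⊤
  DownUp (x ∷ y ∷ r)   = (y < x) × UpDown (y ∷ r)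

  UpDown : List ℕ → Set
  UpDown []            = ⊤
  UpDown (x ∷ [])      = ⊤
  UpDown (x ∷ y ∷ r)   = (x < y) × DownUp (y ∷ r)

mutual
  downUp? : (w : List ℕ) → Dec (DownUp w)
  downUp? []          = yes tt
  downUp? (x ∷ [])    = yes tt
  downUp? (x ∷ y ∷ r) = (y <? x) ×-dec upDown? (y ∷ r)

  upDown? : (w : List ℕ) → Dec (UpDown w)
  upDown? []          = yes tt
  upDown? (x ∷ [])    = yes tt
  upDown? (x ∷ y ∷ r) = (x <? y) ×-dec downUp? (y ∷ r)

-- A permutation of {1,...,n} in one-line notation is a word of length n
-- over {1,...,n} with pairwise distinct letters.
AltPermStart : ℕ → List ℕ → Set
AltPermStart k π = Unique π × DownUp π × (head π ≡ just k)

altPermStart? : (k : ℕ) → (π : List ℕ) → Dec (AltPermStart k π)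
altPermStart? k π = UDec.unique? _≟ℕ_ π ×-dec (downUp? π ×-dec ≡-dec _≟ℕ_ (head π) (just k))

E : ℕ → ℕ → ℕ
E n k = count (altPermStart? k) (words n n)

-- U-words: u₁ = 1, all uᵢ positive, uᵢ + uᵢ₋₁ ≤ i for 2 ≤ i ≤ n

-- UTail i w : w = (u_{i-1}, u_i, u_{i+1}, ...) satisfies the condition from index i on
UTail : ℕ → List ℕ → Set
UTail i []          = ⊤
UTail i (x ∷ [])    = ⊤
UTail i (x ∷ y ∷ r) = (1 ≤ y) × (y + x ≤ i) × UTail (suc i) (y ∷ r)

uTail? : (i : ℕ) → (w : List ℕ) → Dec (UTail i w)
uTail? i []          = yes tt
uTail? i (x ∷ [])    = yes tt
uTail? i (x ∷ y ∷ r) = (1 ≤? y) ×-dec ((y + x ≤? i) ×-dec uTail? (suc i) (y ∷ r))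

UWord : List ℕ → Set
UWord []      = ⊤   -- never used (length n ≥ 1)
UWord (u ∷ r) = (u ≡ 1) × UTail 2 (u ∷ r)

uWord? : (w : List ℕ) → Dec (UWord w)
uWord? []      = yes tt
uWord? (u ∷ r) = (u ≟ℕ 1) ×-dec uTail? 2 (u ∷ r)

UWordEnding : ℕ → List ℕ → Set
UWordEnding m u = UWord u × (last u ≡ just m)

uWordEnding? : (m : ℕ) → (u : List ℕ) → Dec (UWordEnding m u)
uWordEnding? m u = uWord? u ×-dec ≡-dec _≟ℕ_ (last u) (just m)

-- number of U-words of length n with uₙ = m.
-- Every U-word of length n has all letters in {1,...,n}
-- (u₁ = 1 and uᵢ ≤ i - uᵢ₋₁ ≤ i - 1), so enumerating words n n is exhaustive.
numUWords : ℕ → ℕ → ℕ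
numUWords n m = count (uWordEnding? m) (words n n)

-- Both counts satisfy the Entringer recurrence, up to reflecting the index.
-- Deleting the first letter k+1 of a down-up permutation of [1..m+1] and pulling the rest back
-- along the order-reversing bijection φ : [1..m] → [1..m+1] ∖ {k+1} leaves a down-up permutation
-- of [1..m] whose first letter i+1 exceeds m − k, so E(m+1, k+1) = Σ_{i+1 > m−k} E(m, i+1).
-- Deleting the last letter x+1 of a U-word of length m+1 leaves a U-word of length m whose last
-- letter i+1 is only constrained by (x+1) + (i+1) ≤ m+1, so U(m+1, x+1) = Σ_{x+i+2 ≤ m+1} U(m, i+1).
-- For x = m − k the substitution i ↦ m−1−i turns the second recurrence into the first, and
-- induction on m finishes.

module Submission where

open import Defs
open import Data.Nat using (ℕ; zero; suc; _≤_; _<_; _+_; _∸_; _*_; z≤n; s≤s; _≤?_; _<?_)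
open import Data.Nat.Properties
open import Algebra.Properties.CommutativeSemigroup +-commutativeSemigroup
  using () renaming (interchange to +-interchange)
open import Data.List using (List; []; _∷_; map; concatMap; applyUpTo; _++_; _∷ʳ_; length; last)
open import Data.List.Properties using (length-map; map-∘)
open import Data.List.Membership.Propositional using (_∈_)
open import Data.List.Relation.Unary.All as All using (All; []; _∷_)
import Data.List.Relation.Unary.All.Properties as All
open import Data.List.Relation.Unary.Any using (here; there)
open import Data.List.Relation.Unary.Unique.Propositional using (Unique)
open import Data.List.Relation.Unary.AllPairs using ([]; _∷_)
import Data.List.Relation.Unary.Unique.Propositional.Properties as Unique
open import Data.Maybe using (just)
open import Data.Maybe.Properties using (just-injective)
open import Data.Product using (_×_; _,_)
open import Data.Unit using (tt)
open import Function using (_∘_; case_of_; _⇔_; mk⇔; Equivalence)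
open Equivalence using (to; from)
open import Relation.Nullary using (Dec; yes; no; ¬_; contradiction)
open import Relation.Nullary.Decidable using (_×-dec_)
open import Relation.Binary.PropositionalEquality
open import Relation.Binary using (tri<; tri≈; tri>)

private
  variable
    A : Set
    P Q R : Set

𝟙 : Dec P → ℕ
𝟙 (yes _) = 1
𝟙 (no _)  = 0

𝟙-cong : (P? : Dec P) (Q? : Dec Q) → P ⇔ Q → 𝟙 P? ≡ 𝟙 Q?
𝟙-cong (yes _) (yes _) _   = refl
𝟙-cong (yes p) (no ¬q) P⇔Q = contradiction (to P⇔Q p) ¬q
𝟙-cong (no ¬p) (yes q) P⇔Q = contradiction (from P⇔Q q) ¬p
𝟙-cong (no _)  (no _)  _   = refl

𝟙-×-dec : (P? : Dec P) (Q? : Dec Q) → 𝟙 (P? ×-dec Q?) ≡ 𝟙 P? * 𝟙 Q?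
𝟙-×-dec (yes _) (yes _) = refl
𝟙-×-dec (yes _) (no _)  = refl
𝟙-×-dec (no _)  _       = refl

𝟙-⇔-× : (P? : Dec P) (Q? : Dec Q) (R? : Dec R) → P ⇔ (Q × R) → 𝟙 P? ≡ 𝟙 Q? * 𝟙 R?
𝟙-⇔-× P? Q? R? P⇔Q×R = trans (𝟙-cong P? (Q? ×-dec R?) P⇔Q×R) (𝟙-×-dec Q? R?)

𝟙-no : (P? : Dec P) → ¬ P → 𝟙 P? ≡ 0
𝟙-no (yes p) ¬p = contradiction p ¬p
𝟙-no (no _)  _  = refl

∑∈ : List A → (A → ℕ) → ℕ
∑∈ []       f = 0
∑∈ (x ∷ xs) f = f x + ∑∈ xs f

infix 5 ∑∈
syntax ∑∈ xs (λ x → e) = ∑[ x ∈ xs ] e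

∑< : ℕ → (ℕ → ℕ) → ℕ
∑< zero    f = 0
∑< (suc b) f = f 0 + ∑< b (f ∘ suc)

infix 5 ∑<
syntax ∑< b (λ i → e) = ∑[ i < b ] e

count≡∑𝟙 : {P : List ℕ → Set} (P? : ∀ w → Dec (P w)) (ws : List (List ℕ)) →
           count P? ws ≡ ∑[ w ∈ ws ] 𝟙 (P? w)
count≡∑𝟙 P? []       = refl
count≡∑𝟙 P? (w ∷ ws) with P? w
... | yes _ = cong suc (count≡∑𝟙 P? ws)
... | no _  = count≡∑𝟙 P? ws

∑∈-cong : (xs : List A) {f g : A → ℕ} → (∀ x → f x ≡ g x) → ∑∈ xs f ≡ ∑∈ xs g
∑∈-cong []       f≗g = refl
∑∈-cong (x ∷ xs) f≗g = cong₂ _+_ (f≗g x) (∑∈-cong xs f≗g)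

∑∈-zero : (xs : List A) → ∑[ x ∈ xs ] 0 ≡ 0
∑∈-zero []       = refl
∑∈-zero (x ∷ xs) = ∑∈-zero xs

∑∈-++ : (xs ys : List A) (f : A → ℕ) → ∑∈ (xs ++ ys) f ≡ ∑∈ xs f + ∑∈ ys f
∑∈-++ []       ys f = refl
∑∈-++ (x ∷ xs) ys f = trans (cong (f x +_) (∑∈-++ xs ys f)) (sym (+-assoc (f x) _ _))

∑∈-concatMap : {B : Set} (h : A → List B) (xs : List A) (f : B → ℕ) →
               ∑∈ (concatMap h xs) f ≡ ∑[ x ∈ xs ] ∑∈ (h x) f
∑∈-concatMap h []       f = refl
∑∈-concatMap h (x ∷ xs) f =
  trans (∑∈-++ (h x) (concatMap h xs) f) (cong (∑∈ (h x) f +_) (∑∈-concatMap h xs f))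

∑∈-map : {B : Set} (h : A → B) (xs : List A) (f : B → ℕ) → ∑∈ (map h xs) f ≡ ∑∈ xs (f ∘ h)
∑∈-map h []       f = refl
∑∈-map h (x ∷ xs) f = cong (f (h x) +_) (∑∈-map h xs f)

∑∈-applyUpTo : (h : ℕ → A) (b : ℕ) (f : A → ℕ) → ∑∈ (applyUpTo h b) f ≡ ∑[ i < b ] f (h i)
∑∈-applyUpTo h zero    f = refl
∑∈-applyUpTo h (suc b) f = cong (f (h 0) +_) (∑∈-applyUpTo (h ∘ suc) b f)

*-distribˡ-∑∈ : (c : ℕ) (xs : List A) (f : A → ℕ) → c * ∑∈ xs f ≡ ∑[ x ∈ xs ] c * f x
*-distribˡ-∑∈ c []       f = *-zeroʳ c
*-distribˡ-∑∈ c (x ∷ xs) f = trans (*-distribˡ-+ c (f x) _) (cong (c * f x +_) (*-distribˡ-∑∈ c xs f))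

∑<-cong : (b : ℕ) {f g : ℕ → ℕ} → (∀ i → i < b → f i ≡ g i) → ∑< b f ≡ ∑< b g
∑<-cong zero    f≗g = refl
∑<-cong (suc b) f≗g = cong₂ _+_ (f≗g 0 (s≤s z≤n)) (∑<-cong b (λ i i<b → f≗g (suc i) (s≤s i<b)))

∑<-zero : (b : ℕ) → ∑[ i < b ] 0 ≡ 0
∑<-zero zero    = refl
∑<-zero (suc b) = ∑<-zero b

∑<-distrib-+ : (b : ℕ) (f g : ℕ → ℕ) → ∑[ i < b ] (f i + g i) ≡ ∑< b f + ∑< b g
∑<-distrib-+ zero    f g = refl
∑<-distrib-+ (suc b) f g =
  trans (cong (f 0 + g 0 +_) (∑<-distrib-+ b (f ∘ suc) (g ∘ suc)))
        (+-interchange (f 0) (g 0) (∑< b (f ∘ suc)) (∑< b (g ∘ suc)))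

∑<-comm : (a b : ℕ) (f : ℕ → ℕ → ℕ) →
          ∑[ i < a ] ∑[ j < b ] f i j ≡ ∑[ j < b ] ∑[ i < a ] f i j
∑<-comm zero    b f = sym (∑<-zero b)
∑<-comm (suc a) b f =
  trans (cong (∑< b (f 0) +_) (∑<-comm a b (f ∘ suc))) (sym (∑<-distrib-+ b (f 0) _))

∑<-suc : (b : ℕ) (f : ℕ → ℕ) → ∑< (suc b) f ≡ ∑< b f + f b
∑<-suc zero    f = +-comm (f 0) 0
∑<-suc (suc b) f = trans (cong (f 0 +_) (∑<-suc b (f ∘ suc))) (sym (+-assoc (f 0) _ _))

∑<-reverse : (b : ℕ) (f : ℕ → ℕ) → ∑< b f ≡ ∑[ i < b ] f (b ∸ suc i)
∑<-reverse zero    f = refl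
∑<-reverse (suc b) f =
  trans (∑<-suc b f) (trans (+-comm (∑< b f) (f b)) (cong (f b +_) (∑<-reverse b f)))

punchIn : ℕ → ℕ → ℕ
punchIn zero    i       = suc i
punchIn (suc k) zero    = zero
punchIn (suc k) (suc i) = suc (punchIn k i)

punchIn-≢ : ∀ k i → punchIn k i ≢ k
punchIn-≢ zero    i       ()
punchIn-≢ (suc k) zero    ()
punchIn-≢ (suc k) (suc i) eq = punchIn-≢ k i (suc-injective eq)

punchIn-mono-< : ∀ k {y z} → y < z → punchIn k y < punchIn k z
punchIn-mono-< zero    y<z = s≤s y<z
punchIn-mono-< (suc k) {zero}  {suc z} _         = s≤s z≤n
punchIn-mono-< (suc k) {suc y} {suc z} (s≤s y<z) = s≤s (punchIn-mono-< k y<z)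

punchIn-cancel-< : ∀ k {y z} → punchIn k y < punchIn k z → y < z
punchIn-cancel-< zero    (s≤s y<z) = y<z
punchIn-cancel-< (suc k) {zero}  {suc z} _         = s≤s z≤n
punchIn-cancel-< (suc k) {suc y} {suc z} (s≤s y<z) = s≤s (punchIn-cancel-< k y<z)

punchIn-<-pivot : ∀ k {y} → punchIn k y < k ⇔ y < k
punchIn-<-pivot k = mk⇔ (forward k) (backward k)
  where
  forward : ∀ k {y} → punchIn k y < k → y < k
  forward (suc k) {zero}  _         = s≤s z≤n
  forward (suc k) {suc y} (s≤s p<k) = s≤s (forward k p<k)
  backward : ∀ k {y} → y < k → punchIn k y < k
  backward (suc k) {zero}  _         = s≤s z≤n
  backward (suc k) {suc y} (s≤s y<k) = s≤s (backward k y<k)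

punchIn-below : ∀ k {y} → y < k → punchIn k y ≡ y
punchIn-below (suc k) {zero}  _         = refl
punchIn-below (suc k) {suc y} (s≤s y<k) = cong suc (punchIn-below k y<k)

∑<-remove : ∀ b k (f : ℕ → ℕ) → k ≤ b → ∑< (suc b) f ≡ f k + ∑< b (f ∘ punchIn k)
∑<-remove b       zero    f _         = refl
∑<-remove (suc b) (suc k) f (s≤s k≤b) = begin
  f 0 + ∑< (suc b) (f ∘ suc)  ≡⟨ cong (f 0 +_) (∑<-remove b k (f ∘ suc) k≤b) ⟩
  f 0 + (f (suc k) + rest)    ≡⟨ +-assoc (f 0) (f (suc k)) rest ⟨
  f 0 + f (suc k) + rest      ≡⟨ cong (_+ rest) (+-comm (f 0) (f (suc k))) ⟩
  f (suc k) + f 0 + rest      ≡⟨ +-assoc (f (suc k)) (f 0) rest ⟩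
  f (suc k) + (f 0 + rest)    ∎
  where
  open ≡-Reasoning
  rest : ℕ
  rest = ∑< b (f ∘ suc ∘ punchIn k)

∑<-single : ∀ {b} k (f : ℕ → ℕ) → k < b → (∀ i → i ≢ k → f i ≡ 0) → ∑< b f ≡ f k
∑<-single {suc b} k f (s≤s k≤b) f≡0 = begin
  ∑< (suc b) f                      ≡⟨ ∑<-remove b k f k≤b ⟩
  f k + ∑< b (f ∘ punchIn k)        ≡⟨ cong (f k +_) (∑<-cong b (λ i _ → f≡0 _ (punchIn-≢ k i))) ⟩
  f k + ∑< b (λ _ → 0)              ≡⟨ cong (f k +_) (∑<-zero b) ⟩
  f k + 0                           ≡⟨ +-identityʳ (f k) ⟩
  f k                               ∎
  where open ≡-Reasoning

∑-words-∷ : ∀ ℓ b (g : List ℕ → ℕ) →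
            ∑∈ (words (suc ℓ) b) g ≡ ∑[ i < b ] ∑[ w ∈ words ℓ b ] g (suc i ∷ w)
∑-words-∷ ℓ b g = begin
  ∑∈ (concatMap (λ x → map (x ∷_) (words ℓ b)) (range1 b)) g
    ≡⟨ ∑∈-concatMap _ (range1 b) g ⟩
  ∑[ x ∈ range1 b ] ∑∈ (map (x ∷_) (words ℓ b)) g
    ≡⟨ ∑∈-cong (range1 b) (λ x → ∑∈-map (x ∷_) (words ℓ b) g) ⟩
  ∑[ x ∈ range1 b ] ∑[ w ∈ words ℓ b ] g (x ∷ w)
    ≡⟨ ∑∈-applyUpTo suc b _ ⟩
  ∑[ i < b ] ∑[ w ∈ words ℓ b ] g (suc i ∷ w)
    ∎
  where open ≡-Reasoning

∑-words-∷ʳ : ∀ ℓ b (g : List ℕ → ℕ) →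
             ∑∈ (words (suc ℓ) b) g ≡ ∑[ i < b ] ∑[ w ∈ words ℓ b ] g (w ∷ʳ suc i)
∑-words-∷ʳ zero    b g = ∑-words-∷ zero b g
∑-words-∷ʳ (suc ℓ) b g = begin
  ∑∈ (words (suc (suc ℓ)) b) g
    ≡⟨ ∑-words-∷ (suc ℓ) b g ⟩
  ∑[ j < b ] ∑[ w ∈ words (suc ℓ) b ] g (suc j ∷ w)
    ≡⟨ ∑<-cong b (λ j _ → ∑-words-∷ʳ ℓ b (λ w → g (suc j ∷ w))) ⟩
  ∑[ j < b ] ∑[ i < b ] ∑[ w ∈ words ℓ b ] g (suc j ∷ w ∷ʳ suc i)
    ≡⟨ ∑<-comm b b _ ⟩
  ∑[ i < b ] ∑[ j < b ] ∑[ w ∈ words ℓ b ] g (suc j ∷ w ∷ʳ suc i)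
    ≡⟨ ∑<-cong b (λ i _ → ∑-words-∷ ℓ b (λ w → g (w ∷ʳ suc i))) ⟨
  ∑[ i < b ] ∑[ w ∈ words (suc ℓ) b ] g (w ∷ʳ suc i)
    ∎
  where open ≡-Reasoning

∑-words-cong : ∀ ℓ b {g h : List ℕ → ℕ} →
               (∀ w → length w ≡ ℓ → All (_≤ b) w → g w ≡ h w) →
               ∑∈ (words ℓ b) g ≡ ∑∈ (words ℓ b) h
∑-words-cong zero    b g≗h = cong (_+ 0) (g≗h [] refl [])
∑-words-cong (suc ℓ) b {g} {h} g≗h = begin
  ∑∈ (words (suc ℓ) b) g
    ≡⟨ ∑-words-∷ ℓ b g ⟩
  ∑[ i < b ] ∑[ w ∈ words ℓ b ] g (suc i ∷ w)
    ≡⟨ ∑<-cong b (λ i i<b → ∑-words-cong ℓ b (λ w ∣w∣≡ℓ w≤b →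
         g≗h (suc i ∷ w) (cong suc ∣w∣≡ℓ) (i<b ∷ w≤b))) ⟩
  ∑[ i < b ] ∑[ w ∈ words ℓ b ] h (suc i ∷ w)
    ≡⟨ ∑-words-∷ ℓ b h ⟨
  ∑∈ (words (suc ℓ) b) h
    ∎
  where open ≡-Reasoning

∑-words-vanish : ∀ ℓ b (g : List ℕ → ℕ) → (∀ w → length w ≡ ℓ → g w ≡ 0) →
                 ∑∈ (words ℓ b) g ≡ 0
∑-words-vanish ℓ b g g≡0 =
  trans (∑-words-cong ℓ b (λ w ∣w∣≡ℓ _ → g≡0 w ∣w∣≡ℓ)) (∑∈-zero (words ℓ b))

∑-words-punchIn : ∀ ℓ b k (g : List ℕ → ℕ) → k ≤ b →
                  (∀ w → length w ≡ ℓ → suc k ∈ w → g w ≡ 0) →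
                  ∑∈ (words ℓ (suc b)) g ≡ ∑[ w ∈ words ℓ b ] g (map (punchIn (suc k)) w)
∑-words-punchIn zero    b k g k≤b g≡0 = refl
∑-words-punchIn (suc ℓ) b k g k≤b g≡0 = begin
  ∑∈ (words (suc ℓ) (suc b)) g
    ≡⟨ ∑-words-∷ ℓ (suc b) g ⟩
  ∑[ i < suc b ] ∑[ w ∈ words ℓ (suc b) ] g (suc i ∷ w)
    ≡⟨ ∑<-cong (suc b) (λ i _ → ∑-words-punchIn ℓ b k _ k≤b (λ w ∣w∣≡ℓ k∈w →
         g≡0 (suc i ∷ w) (cong suc ∣w∣≡ℓ) (there k∈w))) ⟩
  ∑< (suc b) row
    ≡⟨ ∑<-remove b k row k≤b ⟩
  row k + ∑< b (row ∘ punchIn k)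
    ≡⟨ cong (_+ ∑< b (row ∘ punchIn k)) (∑-words-vanish ℓ b _ (λ w ∣w∣≡ℓ →
         g≡0 _ (cong suc (trans (length-map _ w) ∣w∣≡ℓ)) (here refl))) ⟩
  ∑[ i < b ] ∑[ w ∈ words ℓ b ] g (map (punchIn (suc k)) (suc i ∷ w))
    ≡⟨ ∑-words-∷ ℓ b _ ⟨
  ∑[ w ∈ words (suc ℓ) b ] g (map (punchIn (suc k)) w)
    ∎
  where
  open ≡-Reasoning
  row : ℕ → ℕ
  row i = ∑[ w ∈ words ℓ b ] g (suc i ∷ map (punchIn (suc k)) w)

∑-words-drop-top : ∀ ℓ b (g : List ℕ → ℕ) →
                   (∀ w → length w ≡ ℓ → suc b ∈ w → g w ≡ 0) →
                   ∑∈ (words ℓ (suc b)) g ≡ ∑∈ (words ℓ b) g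
∑-words-drop-top ℓ b g g≡0 =
  trans (∑-words-punchIn ℓ b b g ≤-refl g≡0)
        (∑-words-cong ℓ b (λ w _ w≤b → cong g (map-punchIn-below w w≤b)))
  where
  map-punchIn-below : ∀ w → All (_≤ b) w → map (punchIn (suc b)) w ≡ w
  map-punchIn-below []      []          = refl
  map-punchIn-below (y ∷ w) (y≤b ∷ w≤b) =
    cong₂ _∷_ (punchIn-below (suc b) (s≤s y≤b)) (map-punchIn-below w w≤b)

∑-words-reflect : ∀ ℓ b (g : List ℕ → ℕ) →
                  ∑∈ (words ℓ b) g ≡ ∑[ w ∈ words ℓ b ] g (map (suc b ∸_) w)
∑-words-reflect zero    b g = refl
∑-words-reflect (suc ℓ) b g = begin
  ∑∈ (words (suc ℓ) b) g
    ≡⟨ ∑-words-∷ ℓ b g ⟩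
  ∑[ i < b ] ∑[ w ∈ words ℓ b ] g (suc i ∷ w)
    ≡⟨ ∑<-cong b (λ i _ → ∑-words-reflect ℓ b _) ⟩
  ∑[ i < b ] ∑[ w ∈ words ℓ b ] g (suc i ∷ map (suc b ∸_) w)
    ≡⟨ ∑<-reverse b _ ⟩
  ∑[ i < b ] ∑[ w ∈ words ℓ b ] g (suc (b ∸ suc i) ∷ map (suc b ∸_) w)
    ≡⟨ ∑<-cong b (λ i i<b → ∑∈-cong (words ℓ b) (λ w →
         cong (λ y → g (y ∷ map (suc b ∸_) w)) (sym (+-∸-assoc 1 i<b)))) ⟩
  ∑[ i < b ] ∑[ w ∈ words ℓ b ] g (map (suc b ∸_) (suc i ∷ w))
    ≡⟨ ∑-words-∷ ℓ b _ ⟨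
  ∑[ w ∈ words (suc ℓ) b ] g (map (suc b ∸_) w)
    ∎
  where open ≡-Reasoning

∑-words-head : ∀ ℓ b k (g : List ℕ → ℕ) → k < b → (∀ i w → i ≢ k → g (suc i ∷ w) ≡ 0) →
               ∑∈ (words (suc ℓ) b) g ≡ ∑[ w ∈ words ℓ b ] g (suc k ∷ w)
∑-words-head ℓ b k g k<b g≡0 = trans (∑-words-∷ ℓ b g) (∑<-single k _ k<b (λ i i≢k →
  trans (∑∈-cong (words ℓ b) (λ w → g≡0 i w i≢k)) (∑∈-zero (words ℓ b))))

∑-words-last : ∀ ℓ b k (g : List ℕ → ℕ) → k < b → (∀ i w → i ≢ k → g (w ∷ʳ suc i) ≡ 0) →
               ∑∈ (words (suc ℓ) b) g ≡ ∑[ w ∈ words ℓ b ] g (w ∷ʳ suc k)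
∑-words-last ℓ b k g k<b g≡0 = trans (∑-words-∷ʳ ℓ b g) (∑<-single k _ k<b (λ i i≢k →
  trans (∑∈-cong (words ℓ b) (λ w → g≡0 i w i≢k)) (∑∈-zero (words ℓ b))))

module OrderReversing {B : ℕ → Set} (f : ℕ → ℕ)
  (reverses : ∀ {y z} → B y → B z → y < z ⇔ f z < f y) where

  injective : ∀ {y z} → B y → B z → f y ≡ f z → y ≡ z
  injective {y} {z} y∈B z∈B fy≡fz with <-cmp y z
  ... | tri< y<z _ _ = contradiction (sym fy≡fz) (<⇒≢ (to (reverses y∈B z∈B) y<z))
  ... | tri≈ _ y≡z _ = y≡z
  ... | tri> _ _ z<y = contradiction fy≡fz (<⇒≢ (to (reverses z∈B y∈B) z<y))

  Unique-map⁺ : ∀ {w} → All B w → Unique w → Unique (map f w)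
  Unique-map⁺ []           []         = []
  Unique-map⁺ (y∈B ∷ w∈B) (y∉w ∷ uw) =
    All.map⁺ (All.zipWith (λ (z∈B , y≢z) → y≢z ∘ injective y∈B z∈B) (w∈B , y∉w))
    ∷ Unique-map⁺ w∈B uw

  mutual
    DownUp-map⁺ : ∀ {w} → All B w → UpDown w → DownUp (map f w)
    DownUp-map⁺ {[]}        _                   _          = tt
    DownUp-map⁺ {x ∷ []}    _                   _          = tt
    DownUp-map⁺ {x ∷ y ∷ r} (x∈B ∷ y∈B ∷ r∈B) (x<y , du) =
      to (reverses x∈B y∈B) x<y , UpDown-map⁺ (y∈B ∷ r∈B) du

    UpDown-map⁺ : ∀ {w} → All B w → DownUp w → UpDown (map f w)
    UpDown-map⁺ {[]}        _                   _          = tt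
    UpDown-map⁺ {x ∷ []}    _                   _          = tt
    UpDown-map⁺ {x ∷ y ∷ r} (x∈B ∷ y∈B ∷ r∈B) (y<x , ud) =
      to (reverses y∈B x∈B) y<x , DownUp-map⁺ (y∈B ∷ r∈B) ud

  mutual
    DownUp-map⁻ : ∀ {w} → All B w → DownUp (map f w) → UpDown w
    DownUp-map⁻ {[]}        _                   _            = tt
    DownUp-map⁻ {x ∷ []}    _                   _            = tt
    DownUp-map⁻ {x ∷ y ∷ r} (x∈B ∷ y∈B ∷ r∈B) (fy<fx , ud) =
      from (reverses x∈B y∈B) fy<fx , UpDown-map⁻ (y∈B ∷ r∈B) ud

    UpDown-map⁻ : ∀ {w} → All B w → UpDown (map f w) → DownUp w
    UpDown-map⁻ {[]}        _                   _            = tt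
    UpDown-map⁻ {x ∷ []}    _                   _            = tt
    UpDown-map⁻ {x ∷ y ∷ r} (x∈B ∷ y∈B ∷ r∈B) (fx<fy , du) =
      from (reverses y∈B x∈B) fx<fy , DownUp-map⁻ (y∈B ∷ r∈B) du

∸-≤-swap : ∀ m a k → m ∸ a ≤ k → m ∸ k ≤ a
∸-≤-swap m a k m∸a≤k = m≤n+o⇒m∸n≤o m k (begin
  m            ≤⟨ m≤n+m∸n m a ⟩
  a + (m ∸ a)  ≤⟨ +-monoʳ-≤ a m∸a≤k ⟩
  a + k        ≡⟨ +-comm a k ⟩
  k + a        ∎)
  where open ≤-Reasoning

reflect-reverses : ∀ {m y z} → z ≤ m → y < z ⇔ suc m ∸ z < suc m ∸ y
reflect-reverses z≤m = mk⇔ (λ y<z → ∸-monoʳ-< y<z (m≤n⇒m≤1+n z≤m)) ∸-cancelʳ-<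

E-by-first-letter : ∀ m k → k ≤ m →
                    E (suc m) (suc k) ≡ ∑[ w ∈ words m (suc m) ] 𝟙 (altPermStart? (suc k) (suc k ∷ w))
E-by-first-letter m k k≤m =
  trans (count≡∑𝟙 (altPermStart? (suc k)) (words (suc m) (suc m)))
        (∑-words-head m (suc m) k _ (s≤s k≤m) (λ i w i≢k →
          𝟙-no (altPermStart? (suc k) (suc i ∷ w))
               (λ (_ , _ , i≡k) → i≢k (suc-injective (just-injective i≡k)))))

module FirstLetterRemoval (m k : ℕ) where

  φ : ℕ → ℕ
  φ y = punchIn (suc k) (suc m ∸ y)

  φ-reverses : ∀ {y z} → y ≤ m → z ≤ m → y < z ⇔ φ z < φ y
  φ-reverses _ z≤m = mk⇔
    (punchIn-mono-< (suc k) ∘ to (reflect-reverses z≤m))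
    (from (reflect-reverses z≤m) ∘ punchIn-cancel-< (suc k))

  φ-<-pivot : ∀ a → φ (suc a) < suc k ⇔ m ∸ k < suc a
  φ-<-pivot a = mk⇔
    (λ φa<k → s≤s (∸-≤-swap m a k (≤-pred (to (punchIn-<-pivot (suc k)) φa<k))))
    (λ m∸k≤a → from (punchIn-<-pivot (suc k)) (s≤s (∸-≤-swap m k a (≤-pred m∸k≤a))))

  open OrderReversing φ φ-reverses

  AltPermStart-φ : ∀ i w → All (_≤ m) (suc i ∷ w) →
                   AltPermStart (suc k) (suc k ∷ map φ (suc i ∷ w))
                     ⇔ (m ∸ k < suc i × AltPermStart (suc i) (suc i ∷ w))
  AltPermStart-φ i w w≤m = mk⇔
    (λ { ((_ ∷ uq) , (φi<k , ud) , _) →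
       to (φ-<-pivot i) φi<k , Unique.map⁻ uq , UpDown-map⁻ w≤m ud , refl })
    (λ (m∸k<i , uq , du , _) →
       (All.map⁺ (All.universal (λ y → punchIn-≢ (suc k) (suc m ∸ y) ∘ sym) (suc i ∷ w))
        ∷ Unique-map⁺ w≤m uq)
       , (from (φ-<-pivot i) m∸k<i , UpDown-map⁺ w≤m du) , refl)

E-recurrence : ∀ n k → k ≤ suc n →
               E (suc (suc n)) (suc k) ≡ ∑[ i < suc n ] 𝟙 (suc n ∸ k <? suc i) * E (suc n) (suc i)
E-recurrence n k k≤m = begin
  E (suc m) (suc k)
    ≡⟨ E-by-first-letter m k k≤m ⟩
  ∑∈ (words m (suc m)) G
    ≡⟨ ∑-words-punchIn m m k G k≤m (λ w _ k∈w → 𝟙-no (altPermStart? (suc k) (suc k ∷ w))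
                                                     (λ { ((k∉w ∷ _) , _) → All.lookup k∉w k∈w refl })) ⟩
  ∑[ w ∈ words m m ] G (map (punchIn (suc k)) w)
    ≡⟨ ∑-words-reflect m m _ ⟩
  ∑[ w ∈ words m m ] G (map (punchIn (suc k)) (map (suc m ∸_) w))
    ≡⟨ ∑∈-cong (words m m) (λ w → cong G (map-∘ w)) ⟨
  ∑[ w ∈ words m m ] G (map φ w)
    ≡⟨ ∑-words-∷ n m _ ⟩
  ∑[ i < m ] ∑[ w ∈ words n m ] G (map φ (suc i ∷ w))
    ≡⟨ ∑<-cong m row ⟩
  ∑[ i < m ] χ i * E m (suc i)
    ∎
  where
  m : ℕ
  m = suc n
  open ≡-Reasoning
  open FirstLetterRemoval m k
  G : List ℕ → ℕ
  G w = 𝟙 (altPermStart? (suc k) (suc k ∷ w))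
  χ : ℕ → ℕ
  χ i = 𝟙 (m ∸ k <? suc i)
  row : ∀ i → i < m → ∑[ w ∈ words n m ] G (map φ (suc i ∷ w)) ≡ χ i * E m (suc i)
  row i i<m = begin
    ∑[ w ∈ words n m ] G (map φ (suc i ∷ w))
      ≡⟨ ∑-words-cong n m (λ w _ w≤m → 𝟙-⇔-× _ (m ∸ k <? suc i) (altPermStart? (suc i) (suc i ∷ w))
                                                  (AltPermStart-φ i w (i<m ∷ w≤m))) ⟩
    ∑[ w ∈ words n m ] χ i * 𝟙 (altPermStart? (suc i) (suc i ∷ w))
      ≡⟨ *-distribˡ-∑∈ (χ i) (words n m) _ ⟨
    χ i * (∑[ w ∈ words n m ] 𝟙 (altPermStart? (suc i) (suc i ∷ w)))
      ≡⟨ cong (χ i *_) (E-by-first-letter n i (≤-pred i<m)) ⟨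
    χ i * E m (suc i)
      ∎

last-∷ʳ : ∀ (w : List A) a → last (w ∷ʳ a) ≡ just a
last-∷ʳ []          a = refl
last-∷ʳ (y ∷ [])    a = refl
last-∷ʳ (y ∷ z ∷ w) a = last-∷ʳ (z ∷ w) a

length-∷ʳ : ∀ (w : List A) a → length (w ∷ʳ a) ≡ suc (length w)
length-∷ʳ []      a = refl
length-∷ʳ (y ∷ w) a = cong suc (length-∷ʳ w a)

UTail-++⁻ˡ : ∀ i y r v → UTail i (y ∷ r ++ v) → UTail i (y ∷ r)
UTail-++⁻ˡ i y []      v _               = tt
UTail-++⁻ˡ i y (z ∷ r) v (z≥1 , z+y≤i , t) = z≥1 , z+y≤i , UTail-++⁻ˡ (suc i) z r v t

UTail-∷ʳ⁻ : ∀ i y r a x → last (y ∷ r) ≡ just a →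
            UTail i (y ∷ r ∷ʳ x) → 1 ≤ x × x + a ≤ i + length r
UTail-∷ʳ⁻ i y []      a x last≡a (x≥1 , x+y≤i , _) rewrite just-injective last≡a =
  x≥1 , subst (x + a ≤_) (sym (+-identityʳ i)) x+y≤i
UTail-∷ʳ⁻ i y (z ∷ r) a x last≡a (_ , _ , t) with UTail-∷ʳ⁻ (suc i) z r a x last≡a t
... | x≥1 , x+a≤ = x≥1 , subst (x + a ≤_) (sym (+-suc i (length r))) x+a≤

UTail-∷ʳ⁺ : ∀ i y r a x → last (y ∷ r) ≡ just a →
            UTail i (y ∷ r) → 1 ≤ x → x + a ≤ i + length r → UTail i (y ∷ r ∷ʳ x)
UTail-∷ʳ⁺ i y []      a x last≡a _ x≥1 x+a≤ rewrite just-injective last≡a =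
  x≥1 , subst (x + a ≤_) (+-identityʳ i) x+a≤ , tt
UTail-∷ʳ⁺ i y (z ∷ r) a x last≡a (z≥1 , z+y≤i , t) x≥1 x+a≤ =
  z≥1 , z+y≤i , UTail-∷ʳ⁺ (suc i) z r a x last≡a t x≥1 (subst (x + a ≤_) (+-suc i (length r)) x+a≤)

UTail-letters : ∀ i a r → 1 ≤ a → UTail i (a ∷ r) → All (_< i + length r) r
UTail-letters i a []      _   _                   = []
UTail-letters i a (z ∷ r) a≥1 (z≥1 , z+a≤i , t) =
  ≤-trans (≤-reflexive (+-comm 1 z)) (≤-trans (+-monoʳ-≤ z a≥1) (≤-trans z+a≤i (m≤m+n i _)))
  ∷ All.map (λ {t} t< → subst (t <_) (sym (+-suc i (length r))) t<) (UTail-letters (suc i) z r z≥1 t)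

UWordEnding-∷ʳ : ∀ u a x → 1 ≤ x → last u ≡ just a →
                 UWordEnding x (u ∷ʳ x) ⇔ (x + a ≤ suc (length u) × UWordEnding a u)
UWordEnding-∷ʳ (y ∷ r) a x x≥1 last≡a = mk⇔
  (λ ((y≡1 , t) , _) → let (_ , x+a≤) = UTail-∷ʳ⁻ 2 y r a x last≡a t in
                       x+a≤ , (y≡1 , UTail-++⁻ˡ 2 y r (x ∷ []) t) , last≡a)
  (λ (x+a≤ , (y≡1 , t) , _) → (y≡1 , UTail-∷ʳ⁺ 2 y r a x last≡a t x≥1 x+a≤) , last-∷ʳ (y ∷ r) x)

numUWords-by-last-letter : ∀ m x → x ≤ m →
                           numUWords (suc m) (suc x)
                             ≡ ∑[ w ∈ words m (suc m) ] 𝟙 (uWordEnding? (suc x) (w ∷ʳ suc x))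
numUWords-by-last-letter m x x≤m =
  trans (count≡∑𝟙 (uWordEnding? (suc x)) (words (suc m) (suc m)))
        (∑-words-last m (suc m) x _ (s≤s x≤m) (λ i w i≢x →
          𝟙-no (uWordEnding? (suc x) (w ∷ʳ suc i))
               (λ (_ , last≡x) →
                  i≢x (suc-injective (just-injective (trans (sym (last-∷ʳ w (suc i))) last≡x))))))

numUWords-recurrence : ∀ n x → x ≤ suc n →
                       numUWords (suc (suc n)) (suc x)
                         ≡ ∑[ i < suc n ] 𝟙 (suc x + suc i ≤? suc (suc n)) * numUWords (suc n) (suc i)
numUWords-recurrence n x x≤m = begin
  numUWords (suc m) (suc x)                       ≡⟨ numUWords-by-last-letter m x x≤m ⟩
  ∑∈ (words m (suc m)) H                          ≡⟨ ∑-words-drop-top m m H top∉prefix ⟩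
  ∑∈ (words m m) H                                ≡⟨ ∑-words-∷ʳ n m H ⟩
  ∑[ i < m ] ∑[ v ∈ words n m ] H (v ∷ʳ suc i)    ≡⟨ ∑<-cong m row ⟩
  ∑[ i < m ] χ i * numUWords m (suc i)            ∎
  where
  m : ℕ
  m = suc n
  open ≡-Reasoning
  H : List ℕ → ℕ
  H w = 𝟙 (uWordEnding? (suc x) (w ∷ʳ suc x))
  χ : ℕ → ℕ
  χ i = 𝟙 (suc x + suc i ≤? suc m)
  -- The letter in position j ≥ 2 of a U-word is below j, so m + 1 occurs in none of the first m letters.
  top∉prefix : ∀ w → length w ≡ m → suc m ∈ w → H w ≡ 0
  top∉prefix (y ∷ r) ∣w∣≡m m+1∈w =
    𝟙-no (uWordEnding? (suc x) (y ∷ r ∷ʳ suc x)) λ ((y≡1 , t) , _) →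
    let prefix = UTail-++⁻ˡ 2 y r (suc x ∷ []) t in
    case m+1∈w of λ where
      (here m+1≡y)   → 1+n≢0 (suc-injective (trans m+1≡y y≡1))
      (there m+1∈r) → <-irrefl (cong (suc ∘ suc) (sym (suc-injective ∣w∣≡m)))
                                (All.lookup (UTail-letters 2 y r (≤-reflexive (sym y≡1)) prefix) m+1∈r)
  extend : ∀ i v → length v ≡ n →
           UWordEnding (suc x) (v ∷ʳ suc i ∷ʳ suc x)
             ⇔ (suc x + suc i ≤ suc m × UWordEnding (suc i) (v ∷ʳ suc i))
  extend i v ∣v∣≡n rewrite sym ∣v∣≡n | sym (length-∷ʳ v (suc i)) =
    UWordEnding-∷ʳ (v ∷ʳ suc i) (suc i) (suc x) (s≤s z≤n) (last-∷ʳ v (suc i))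
  row : ∀ i → i < m → ∑[ v ∈ words n m ] H (v ∷ʳ suc i) ≡ χ i * numUWords m (suc i)
  row i i<m = begin
    ∑[ v ∈ words n m ] H (v ∷ʳ suc i)
      ≡⟨ ∑-words-cong n m (λ v ∣v∣≡n _ →
           𝟙-⇔-× _ (suc x + suc i ≤? suc m) (uWordEnding? (suc i) (v ∷ʳ suc i)) (extend i v ∣v∣≡n)) ⟩
    ∑[ v ∈ words n m ] χ i * 𝟙 (uWordEnding? (suc i) (v ∷ʳ suc i))
      ≡⟨ *-distribˡ-∑∈ (χ i) (words n m) _ ⟨
    χ i * (∑[ v ∈ words n m ] 𝟙 (uWordEnding? (suc i) (v ∷ʳ suc i)))
      ≡⟨ cong (χ i *_) (numUWords-by-last-letter n i (≤-pred i<m)) ⟨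
    χ i * numUWords m (suc i)
      ∎

numUWords≡E : ∀ m k → k ≤ m → numUWords (suc m) (suc (m ∸ k)) ≡ E (suc m) (suc k)
numUWords≡E zero    zero z≤n = refl
numUWords≡E (suc n) k    k≤m = begin
  numUWords (suc m) (suc (m ∸ k))
    ≡⟨ numUWords-recurrence n (m ∸ k) (m∸n≤m m k) ⟩
  ∑[ i < m ] 𝟙 (suc (m ∸ k) + suc i ≤? suc m) * numUWords m (suc i)
    ≡⟨ ∑<-cong m term ⟩
  ∑[ i < m ] 𝟙 (m ∸ k <? suc (n ∸ i)) * E m (suc (n ∸ i))
    ≡⟨ ∑<-reverse m (λ i → 𝟙 (m ∸ k <? suc i) * E m (suc i)) ⟨
  ∑[ i < m ] 𝟙 (m ∸ k <? suc i) * E m (suc i)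
    ≡⟨ E-recurrence n k k≤m ⟨
  E (suc m) (suc k)
    ∎
  where
  m : ℕ
  m = suc n
  open ≡-Reasoning
  threshold-reflect : ∀ a {i} → i ≤ n → suc a + suc i ≤ suc m ⇔ a < suc (n ∸ i)
  threshold-reflect a {i} i≤n = mk⇔
    (λ le → s≤s (m+n≤o⇒m≤o∸n a (≤-pred (subst (_≤ m) (+-suc a i) (≤-pred le)))))
    (λ { (s≤s a≤n∸i) → s≤s (subst (_≤ m) (sym (+-suc a i)) (s≤s (m≤o∸n⇒m+n≤o a i≤n a≤n∸i))) })
  term : ∀ i → i < m →
         𝟙 (suc (m ∸ k) + suc i ≤? suc m) * numUWords m (suc i)
           ≡ 𝟙 (m ∸ k <? suc (n ∸ i)) * E m (suc (n ∸ i))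
  term i i<m = cong₂ _*_
    (𝟙-cong (suc (m ∸ k) + suc i ≤? suc m) (m ∸ k <? suc (n ∸ i)) (threshold-reflect (m ∸ k) (≤-pred i<m)))
    (trans (cong (numUWords m ∘ suc) (sym (m∸[m∸n]≡n (≤-pred i<m)))) (numUWords≡E n (n ∸ i) (m∸n≤m n i)))

theorem11 : (n k : ℕ) → 1 ≤ n → 1 ≤ k → k ≤ n → numUWords n (n + 1 ∸ k) ≡ E n k
theorem11 (suc m) (suc k) _ _ (s≤s k≤m) =
  trans (cong (numUWords (suc m)) (trans (cong (_∸ k) (+-comm m 1)) (+-∸-assoc 1 k≤m))) (numUWords≡E m k k≤m)
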